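{- Let $G$ be either a path $P_n$ with $n\ge4$ or a cycle $C_n$ with $n\ge5$, and write $n=6q+r$ with non-negative integers $q$ and $r\in\{0,1,2,3,4,5\}$. Then $\gamma^{\mathrm{FD}}(G)=\gamma^{\mathrm{FTD}}(G)=4q+r$ if $r\in\{0,1,2,3,4\}$, and $\gamma^{\mathrm{FD}}(G)=\gamma^{\mathrm{FTD}}(G)=4q+4$ if $r=5$.
   Context: For a vertex $v$ of $G=(V,E)$, $N(v)$ is its open and $N[v]=N(v)\cup\{v\}$ its closed neighborhood. A set $C\subseteq V$ is full-separating if for all distinct $u,v\in V$, $(N(v)\cap C)\setminus\{u\}\neq(N(u)\cap C)\setminus\{v\}$; dominating if $N[v]\cap C\neq\emptyset$ for all $v$; total-dominating if $N(v)\cap C\neq\emptyset$ for all $v$. An FD-code is a full-separating dominating set and an FTD-code a full-separating total-dominating set; $\gamma^{\mathrm{FD}}(G)$, $\gamma^{\mathrm{FTD}}(G)$ are their minimum cardinalities. $P_n$ is the path and $C_n$ the cycle on $n$ vertices. -}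

module Defs where

open import Data.Nat using (ℕ; zero; suc; _+_; _*_; _≤_)
open import Data.Fin using (Fin; toℕ)
open import Data.Fin.Subset using (Subset; _∈_; ∣_∣)
open import Data.Product using (_×_; ∃)
open import Data.Sum using (_⊎_)
open import Relation.Nullary using (¬_)
open import Relation.Binary.PropositionalEquality using (_≡_; _≢_)
open import Function.Bundles using (_⇔_)

Graph : ℕ → Set₁
Graph n = Fin n → Fin n → Set

PathG : (n : ℕ) → Graph n
PathG n u v = (suc (toℕ u) ≡ toℕ v) ⊎ (suc (toℕ v) ≡ toℕ u)

CycleG : (n : ℕ) → Graph n
CycleG n u v = PathG n u v
             ⊎ ((toℕ u ≡ 0 × suc (toℕ v) ≡ n) ⊎ (toℕ v ≡ 0 × suc (toℕ u) ≡ n))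

module _ {n : ℕ} (G : Graph n) where

  NC∖ : Subset n → Fin n → Fin n → Fin n → Set
  NC∖ C v u w = G v w × w ∈ C × w ≢ u

  FullSeparating : Subset n → Set
  FullSeparating C = ∀ u v → u ≢ v →
    ¬ (∀ w → NC∖ C v u w ⇔ NC∖ C u v w)

  Dominating : Subset n → Set
  Dominating C = ∀ v → ∃ λ w → (w ≡ v ⊎ G v w) × w ∈ C

  TotalDominating : Subset n → Set
  TotalDominating C = ∀ v → ∃ λ w → G v w × w ∈ C

  FDCode : Subset n → Set
  FDCode C = FullSeparating C × Dominating C

  FTDCode : Subset n → Set
  FTDCode C = FullSeparating C × TotalDominating C

IsMinimum : {n : ℕ} → (Subset n → Set) → ℕ → Set
IsMinimum P k = (∃ λ C → P C × ∣ C ∣ ≡ k) × (∀ C → P C → k ≤ ∣ C ∣)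

γFD : {n : ℕ} → Graph n → ℕ → Set
γFD G k = IsMinimum (FDCode G) k

γFTD : {n : ℕ} → Graph n → ℕ → Set
γFTD G k = IsMinimum (FTDCode G) k

target : ℕ → ℕ → ℕ
target q 5 = 4 * q + 4
target q r = 4 * q + r

-- A code on P_n or C_n is read as the 0/1 word of its indicator along the path or around the
-- cycle. Separating all pairs at distance one or two and dominating every vertex is a condition
-- on each five consecutive letters (fdWindow), and a slightly stronger condition (ftdWindow) at
-- every position already makes a word a full-separating total-dominating code.
-- Lower bound: the least number of ones of a word satisfying fdWindow, given its first and last
-- four letters, obeys a min-plus recursion over the last four letters; it grows by exactly 4 every
-- 6 letters as soon as it does so over one period, which, like the small lengths, is checked by
-- evaluation.
-- Upper bound: repeating the block 111100 and closing with a short tail gives words satisfying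
-- ftdWindow with exactly 4q + r ones (4q + 4 when r = 5).

module Submission where

open import Defs
open import Data.Bool using (Bool; true; false; _∧_; _∨_; not; if_then_else_; T)
open import Data.Bool.Properties using (T-∧; T-∨; T-≡; T?)
open import Data.Empty using (⊥-elim)
open import Data.Fin as Fin using (Fin; toℕ; fromℕ<) renaming (_≟_ to _≟ᶠ_)
open import Data.Fin.Properties using (toℕ-injective; toℕ-fromℕ<; toℕ<n)
open import Data.Fin.Subset using (Subset; _∈_; ∣_∣)
open import Data.Nat
open import Data.Nat.DivMod
open import Data.Nat.Properties
open import Data.Nat.Tactic.RingSolver using (solve-∀)
open import Data.Product using (_×_; _,_; proj₁; proj₂; ∃; map₁; map₂)
open import Data.Sum using (_⊎_; inj₁; inj₂; [_,_])
import Data.Sum as Sum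
open import Data.Vec using ([]; _∷_; lookup; tabulate)
open import Data.Vec.Properties using ([]=⇒lookup; lookup⇒[]=)
open import Function using (_∘_)
open import Function.Bundles using (Equivalence; _⇔_; mk⇔)
open import Relation.Binary.Definitions using (tri<; tri≈; tri>)
open import Relation.Binary.PropositionalEquality hiding ([_])
open import Relation.Nullary using (¬_; Dec; yes; no)
open import Relation.Nullary.Decidable using (map′; _×-dec_; _⊎-dec_; _→-dec_; from-yes)

open Equivalence using (to; from)

-- Words and their windows

bit : Bool → ℕ
bit b = if b then 1 else 0

count : (ℕ → Bool) → ℕ → ℕ
count s zero    = 0
count s (suc L) = bit (s 0) + count (s ∘ suc) L

count-cong : ∀ {s t} L → (∀ {i} → i < L → s i ≡ t i) → count s L ≡ count t L
count-cong zero    eq = refl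
count-cong (suc L) eq = cong₂ _+_ (cong bit (eq (s≤s z≤n))) (count-cong L (eq ∘ s≤s))

indicator : ∀ {n} → Subset n → ℕ → Bool
indicator []       _       = false
indicator (b ∷ _)  zero    = b
indicator (_ ∷ bs) (suc i) = indicator bs i

indicator-lookup : ∀ {n} (C : Subset n) w → indicator C (toℕ w) ≡ lookup C w
indicator-lookup (_ ∷ _)  Fin.zero    = refl
indicator-lookup (_ ∷ bs) (Fin.suc w) = indicator-lookup bs w

∈⇒indicator : ∀ {n} {C : Subset n} {w} → w ∈ C → T (indicator C (toℕ w))
∈⇒indicator {C = C} {w} w∈C = from T-≡ (trans (indicator-lookup C w) ([]=⇒lookup w∈C))

indicator⇒∈ : ∀ {n} {C : Subset n} {w} → T (indicator C (toℕ w)) → w ∈ C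
indicator⇒∈ {C = C} {w} h = lookup⇒[]= w C (trans (sym (indicator-lookup C w)) (to T-≡ h))

indicator⇒< : ∀ {n} (C : Subset n) i → T (indicator C i) → i < n
indicator⇒< (_ ∷ _)  zero    _ = s≤s z≤n
indicator⇒< (_ ∷ bs) (suc i) h = s≤s (indicator⇒< bs i h)

indicator-≥ : ∀ {n} (C : Subset n) i → n ≤ i → indicator C i ≡ false
indicator-≥ []       _       _         = refl
indicator-≥ (_ ∷ bs) (suc i) (s≤s n≤i) = indicator-≥ bs i n≤i

indicator-tabulate : ∀ n (s : ℕ → Bool) {i} → i < n → indicator (tabulate {n = n} (s ∘ toℕ)) i ≡ s i
indicator-tabulate (suc n) s {zero}  _         = refl
indicator-tabulate (suc n) s {suc i} (s≤s i<n) = indicator-tabulate n (s ∘ suc) i<n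

∣∣≡count : ∀ {n} (C : Subset n) → ∣ C ∣ ≡ count (indicator C) n
∣∣≡count []           = refl
∣∣≡count (true ∷ bs)  = cong suc (∣∣≡count bs)
∣∣≡count (false ∷ bs) = ∣∣≡count bs

letter⇒vertex : ∀ {n} {C : Subset n} {i} → T (indicator C i) → ∃ λ w → toℕ w ≡ i × w ∈ C
letter⇒vertex {C = C} {i} h = fromℕ< i<n , toℕ-fromℕ< i<n ,
                                 indicator⇒∈ (subst (T ∘ indicator C) (sym (toℕ-fromℕ< i<n)) h)
  where i<n : i < _
        i<n = indicator⇒< C i h

Bool⁴→Bool Bool⁵→Bool : Set
Bool⁴→Bool = Bool → Bool → Bool → Bool → Bool
Bool⁵→Bool = Bool → Bool⁴→Bool

-- For the letters a … e at positions k … k+4 of the word of a code on a path or a cycle,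
-- b ∨ e says that the pair {k+2, k+3} is separated, a ∨ e that {k+1, k+3} is, and
-- c ∨ d ∨ e (resp. c ∨ e) that k+3 is dominated (resp. totally dominated).
fdWindow ftdWindow : Bool⁵→Bool
fdWindow  a b c d e = (b ∨ e) ∧ (a ∨ e) ∧ (c ∨ d ∨ e)
ftdWindow a b c d e = (b ∨ e) ∧ (a ∨ e) ∧ (c ∨ e)

record WindowAt (φ : Bool⁵→Bool) (y : ℕ → Bool) (k : ℕ) : Set where
  constructor window
  field holds : T (φ (y k) (y (1 + k)) (y (2 + k)) (y (3 + k)) (y (4 + k)))

open WindowAt public

window-shift : ∀ {φ y k} → WindowAt φ y (suc k) → WindowAt φ (y ∘ suc) k
window-shift w = window (holds w)

WindowAt-transport : ∀ {φ y z k k′} → (∀ {j} → j ≤ 4 → y (j + k) ≡ z (j + k′)) →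
                     WindowAt φ y k → WindowAt φ z k′
WindowAt-transport {φ} {y} {z} {k} {k′} same (window w) = window (subst T letters w)
  where letters : φ (y k) (y (1 + k)) (y (2 + k)) (y (3 + k)) (y (4 + k)) ≡
                  φ (z k′) (z (1 + k′)) (z (2 + k′)) (z (3 + k′)) (z (4 + k′))
        letters rewrite same {0} z≤n | same {1} (s≤s z≤n) | same {2} (s≤s (s≤s z≤n))
                      | same {3} (s≤s (s≤s (s≤s z≤n))) | same {4} (s≤s (s≤s (s≤s (s≤s z≤n)))) = refl

window? : ∀ φ y k → Dec (WindowAt φ y k)
window? φ y k = map′ window holds (T? _)

Windows : Bool⁵→Bool → (ℕ → Bool) → ℕ → Set
Windows φ y B = ∀ {k} → k < B → WindowAt φ y k

Windows-mono : ∀ {φ y B B′} → B′ ≤ B → Windows φ y B → Windows φ y B′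
Windows-mono B′≤B ws k<B′ = ws (≤-trans k<B′ B′≤B)

fdWindow-intro : ∀ {y k} → T (y (1 + k)) ⊎ T (y (4 + k)) → T (y k) ⊎ T (y (4 + k)) →
                 T (y (2 + k)) ⊎ T (y (3 + k)) ⊎ T (y (4 + k)) → WindowAt fdWindow y k
fdWindow-intro {y} {k} p q r = window (from (T-∧ {y (1 + k) ∨ y (4 + k)}) (from T-∨ p ,
  from (T-∧ {y k ∨ y (4 + k)}) (from T-∨ q , from (T-∨ {y (2 + k)}) (Sum.map₂ (from T-∨) r))))

ftdWindow-last : ∀ {y k} → T (y (4 + k)) → WindowAt ftdWindow y k
ftdWindow-last {y} {k} e = window (from (T-∧ {y (1 + k) ∨ y (4 + k)}) (from (T-∨ {y (1 + k)}) (inj₂ e) ,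
  from (T-∧ {y k ∨ y (4 + k)}) (from (T-∨ {y k}) (inj₂ e) , from (T-∨ {y (2 + k)}) (inj₂ e))))

module _ {y : ℕ → Bool} {k : ℕ} (w : WindowAt ftdWindow y k) where

  private
    parts : T (y (1 + k) ∨ y (4 + k)) × T (y k ∨ y (4 + k)) × T (y (2 + k) ∨ y (4 + k))
    parts with to (T-∧ {y (1 + k) ∨ y (4 + k)}) (holds w)
    ... | p , qr = p , to (T-∧ {y k ∨ y (4 + k)}) qr

  ftdWindow-adjacent : T (y (1 + k)) ⊎ T (y (4 + k))
  ftdWindow-adjacent = to T-∨ (proj₁ parts)

  ftdWindow-distance-two : T (y k) ⊎ T (y (4 + k))
  ftdWindow-distance-two = to T-∨ (proj₁ (proj₂ parts))

  ftdWindow-total : T (y (2 + k)) ⊎ T (y (4 + k))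
  ftdWindow-total = to T-∨ (proj₂ (proj₂ parts))

-- Lower bounds by dynamic programming

-- The least number of ones in letters 4 … L+3 of a word that starts with a b c d, satisfies
-- fdWindow at positions 0 … L-1 and whose letters L … L+3 satisfy F; final letters violating F
-- cost 4 instead of being excluded, which keeps it a lower bound and is enough for the values
-- computed below.
minOnes : Bool⁴→Bool → Bool → Bool → Bool → Bool → ℕ → ℕ
minOnes F a b c d zero    = if F a b c d then 0 else 4
minOnes F a b c d (suc L) =
  if fdWindow a b c d false
  then minOnes F b c d false L ⊓ suc (minOnes F b c d true L)
  else suc (minOnes F b c d true L)

minOnes-step : ∀ F a b c d e L → T (fdWindow a b c d e) →
               minOnes F a b c d (suc L) ≤ bit e + minOnes F b c d e L
minOnes-step F a b c d true L _ with fdWindow a b c d false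
... | true  = m⊓n≤n _ _
... | false = ≤-refl
minOnes-step F a b c d false L w with fdWindow a b c d false
minOnes-step F a b c d false L () | false
... | true  = m⊓n≤m _ _

minOnes-≤-count : ∀ F L y → Windows fdWindow y L → T (F (y L) (y (1 + L)) (y (2 + L)) (y (3 + L))) →
                  minOnes F (y 0) (y 1) (y 2) (y 3) L ≤ count (y ∘ (4 +_)) L
minOnes-≤-count F zero    y _ f with F (y 0) (y 1) (y 2) (y 3)
... | true = z≤n
minOnes-≤-count F (suc L) y ws f =
  ≤-trans (minOnes-step F (y 0) (y 1) (y 2) (y 3) (y 4) L (holds (ws (s≤s z≤n))))
          (+-monoʳ-≤ (bit (y 4)) (minOnes-≤-count F L (y ∘ suc) (window-shift ∘ ws ∘ s≤s) f))

minOnes-periodic : ∀ F → (∀ a b c d → minOnes F a b c d 10 ≡ 4 + minOnes F a b c d 4) →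
                   ∀ k a b c d → minOnes F a b c d (10 + k) ≡ 4 + minOnes F a b c d (4 + k)
minOnes-periodic F base zero    = base
minOnes-periodic F base (suc k) a b c d with fdWindow a b c d false
... | true  rewrite minOnes-periodic F base k b c d false | minOnes-periodic F base k b c d true
  = sym (+-distribˡ-⊓ 4 _ _)
... | false rewrite minOnes-periodic F base k b c d true = refl

all-Bool? : {P : Bool → Set} → (∀ b → Dec (P b)) → Dec (∀ b → P b)
all-Bool? P? = map′ (λ (f , t) → λ { false → f ; true → t }) (λ h → h false , h true)
                    (P? false ×-dec P? true)

all-Bool⁴? : {P : Bool → Bool → Bool → Bool → Set} → (∀ a b c d → Dec (P a b c d)) →
             Dec (∀ a b c d → P a b c d)
all-Bool⁴? P? = all-Bool? λ a → all-Bool? λ b → all-Bool? λ c → all-Bool? λ d → P? a b c d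

*-suc-+ : ∀ k q m → k * suc q + m ≡ k + (k * q + m)
*-suc-+ k q m = trans (cong (_+ m) (*-suc k q)) (+-assoc k (k * q) m)

target-suc : ∀ q r → target (suc q) r ≡ 4 + target q r
target-suc q 0 = *-suc-+ 4 q 0
target-suc q 1 = *-suc-+ 4 q 1
target-suc q 2 = *-suc-+ 4 q 2
target-suc q 3 = *-suc-+ 4 q 3
target-suc q 4 = *-suc-+ 4 q 4
target-suc q 5 = *-suc-+ 4 q 4
target-suc q r@(suc (suc (suc (suc (suc (suc _)))))) = *-suc-+ 4 q r

target-blocks : ∀ q r → target q r ≡ 4 * q + target 0 r
target-blocks zero    r = refl
target-blocks (suc q) r = trans (target-suc q r) (trans (cong (4 +_) (target-blocks q r)) (sym (*-suc-+ 4 q _)))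

target-≤-periodic : ∀ c (h : ℕ → ℕ) → c ≤ 12 → (∀ m → 12 ≤ m → h (6 + m) ≡ 4 + h m) →
  (∀ {q} → q < 3 → ∀ {r} → r < 6 → c ≤ 6 * q + r → target q r ≤ h (6 * q + r)) →
  ∀ q r → r < 6 → c ≤ 6 * q + r → target q r ≤ h (6 * q + r)
target-≤-periodic c h c≤12 periodic small q@(suc (suc (suc p))) r r<6 _ = begin
  target q r               ≡⟨ target-suc (2 + p) r ⟩
  4 + target (2 + p) r     ≤⟨ +-monoʳ-≤ 4 (target-≤-periodic c h c≤12 periodic small (suc (suc p)) r r<6
                                              (≤-trans c≤12 12≤m)) ⟩
  4 + h m                  ≡⟨ periodic m 12≤m ⟨
  h (6 + m)                ≡⟨ cong h (*-suc-+ 6 (2 + p) r) ⟨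
  h (6 * q + r)            ∎
  where
  open ≤-Reasoning
  m : ℕ
  m = 6 * (2 + p) + r
  12≤m : 12 ≤ m
  12≤m = ≤-trans (*-monoʳ-≤ 6 (s≤s (s≤s z≤n))) (m≤m+n (6 * (2 + p)) r)
target-≤-periodic c h _ _ small 0 r r<6 = small z<s r<6
target-≤-periodic c h _ _ small 1 r r<6 = small (s<s z<s) r<6
target-≤-periodic c h _ _ small 2 r r<6 = small (s<s (s<s z<s)) r<6

-- The word of a code on P_n is 1110 x₀ x₁ … x_{n-1} 0 0 …, vertex i sitting at position 4 + i:
-- position 3 stands for the absent vertex -1, and the leading ones make every window condition
-- about a pair or a vertex before vertex 0 hold trivially.
pad : (ℕ → Bool) → ℕ → Bool
pad x 0 = true
pad x 1 = true
pad x 2 = true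
pad x 3 = false
pad x (suc (suc (suc (suc i)))) = x i

pathEnd : Bool⁴→Bool
pathEnd a b c d = fdWindow a b c d false

pathBound : ℕ → ℕ
pathBound = minOnes pathEnd true true true false

pathBound-periodic : ∀ m → 4 ≤ m → pathBound (6 + m) ≡ 4 + pathBound m
pathBound-periodic m 4≤m with m≤n⇒∃[o]m+o≡n 4≤m
... | k , refl = minOnes-periodic pathEnd base k true true true false
  where base : ∀ a b c d → minOnes pathEnd a b c d 10 ≡ 4 + minOnes pathEnd a b c d 4
        base = from-yes (all-Bool⁴? λ a b c d → minOnes pathEnd a b c d 10 ≟ 4 + minOnes pathEnd a b c d 4)

pathBound-target : ∀ q r → r < 6 → 4 ≤ 6 * q + r → target q r ≤ pathBound (6 * q + r)
pathBound-target = target-≤-periodic 4 pathBound (m≤m+n 4 8)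
  (λ m 12≤m → pathBound-periodic m (≤-trans (m≤m+n 4 8) 12≤m))
  (from-yes (allUpTo? (λ q → allUpTo? (λ r → 4 ≤? 6 * q + r →-dec target q r ≤? pathBound (6 * q + r)) 6) 3))

-- On C_N the first four letters a₀ … a₃ reappear after the last letter, closing four more windows.
cycleEnd : Bool → Bool → Bool → Bool → Bool⁴→Bool
cycleEnd a₀ a₁ a₂ a₃ p q r t =
  fdWindow p q r t a₀ ∧ fdWindow q r t a₀ a₁ ∧ fdWindow r t a₀ a₁ a₂ ∧ fdWindow t a₀ a₁ a₂ a₃

cycleEnd-intro : ∀ {y L} → WindowAt fdWindow y L → WindowAt fdWindow y (1 + L) →
  WindowAt fdWindow y (2 + L) → WindowAt fdWindow y (3 + L) →
  T (cycleEnd (y (4 + L)) (y (5 + L)) (y (6 + L)) (y (7 + L)) (y L) (y (1 + L)) (y (2 + L)) (y (3 + L)))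
cycleEnd-intro (window w₀) (window w₁) (window w₂) (window w₃) =
  from T-∧ (w₀ , from T-∧ (w₁ , from T-∧ (w₂ , w₃)))

weight : Bool → Bool → Bool → Bool → ℕ
weight a b c d = bit a + bit b + bit c + bit d

cycleBound : Bool → Bool → Bool → Bool → ℕ → ℕ
cycleBound a b c d n = weight a b c d + minOnes (cycleEnd a b c d) a b c d (n ∸ 4)

cycleBound-periodic : ∀ a b c d m → 8 ≤ m → cycleBound a b c d (6 + m) ≡ 4 + cycleBound a b c d m
cycleBound-periodic a b c d m 8≤m with m≤n⇒∃[o]m+o≡n 8≤m
... | k , refl = trans (cong (weight a b c d +_) (minOnes-periodic (cycleEnd a b c d) (base a b c d) k a b c d))
                      (x+[4+y]≡4+[x+y] (weight a b c d) _)
  where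
  base : ∀ a b c d p q r t → minOnes (cycleEnd a b c d) p q r t 10 ≡ 4 + minOnes (cycleEnd a b c d) p q r t 4
  base = from-yes (all-Bool⁴? λ a b c d → all-Bool⁴? λ p q r t →
           minOnes (cycleEnd a b c d) p q r t 10 ≟ 4 + minOnes (cycleEnd a b c d) p q r t 4)
  x+[4+y]≡4+[x+y] : ∀ x y → x + (4 + y) ≡ 4 + (x + y)
  x+[4+y]≡4+[x+y] = solve-∀

cycleBound-target : ∀ a b c d q r → r < 6 → 5 ≤ 6 * q + r → target q r ≤ cycleBound a b c d (6 * q + r)
cycleBound-target a b c d = target-≤-periodic 5 (cycleBound a b c d) (m≤m+n 5 7)
  (λ m 12≤m → cycleBound-periodic a b c d m (≤-trans (m≤m+n 8 4) 12≤m)) (small a b c d)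
  where
  small : ∀ a b c d {q} → q < 3 → ∀ {r} → r < 6 → 5 ≤ 6 * q + r →
          target q r ≤ cycleBound a b c d (6 * q + r)
  small = from-yes (all-Bool⁴? λ a b c d → allUpTo? (λ q → allUpTo? (λ r →
            5 ≤? 6 * q + r →-dec target q r ≤? cycleBound a b c d (6 * q + r)) 6) 3)

count-4+ : ∀ s L → count s (4 + L) ≡ weight (s 0) (s 1) (s 2) (s 3) + count (s ∘ (4 +_)) L
count-4+ s L = reassociate (bit (s 0)) (bit (s 1)) (bit (s 2)) (bit (s 3)) (count (s ∘ (4 +_)) L)
  where reassociate : ∀ a b c d e → a + (b + (c + (d + e))) ≡ a + b + c + d + e
        reassociate = solve-∀

module _ {n} (G : Graph n) (C : Subset n) where

  Separates : Fin n → Fin n → Set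
  Separates u v = ¬ (∀ w → NC∖ G C v u w ⇔ NC∖ G C u v w)

  Separates-sym : ∀ {u v} → Separates v u → Separates u v
  Separates-sym sep same = sep λ w → mk⇔ (from (same w)) (to (same w))

  separatesˡ : ∀ {u v w} → G u w → w ∈ C → w ≢ v → ¬ G v w → Separates u v
  separatesˡ Guw w∈C w≢v ¬Gvw same = ¬Gvw (proj₁ (from (same _) (Guw , w∈C , w≢v)))

  separatesʳ : ∀ {u v w} → G v w → w ∈ C → w ≢ u → ¬ G u w → Separates u v
  separatesʳ Gvw w∈C w≢u ¬Guw same = ¬Guw (proj₁ (to (same _) (Gvw , w∈C , w≢u)))

  separation-forces : ∀ {u v} {P : Set} → Dec P → (∀ w → ¬ G w w) → Separates u v →
    (∀ w → G u w → w ∈ C → w ≢ v → G v w ⊎ P) →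
    (∀ w → G v w → w ∈ C → w ≢ u → G u w ⊎ P) → P
  separation-forces (yes p) _     _   _      _      = p
  separation-forces {P = P} (no ¬p) loops sep shareᵤ shareᵥ =
    ⊥-elim (sep λ w → mk⇔ (shared shareᵥ) (shared shareᵤ))
    where
    shared : ∀ {s t w} → (∀ w → G t w → w ∈ C → w ≢ s → G s w ⊎ P) →
             G t w × w ∈ C × w ≢ s → G s w × w ∈ C × w ≢ t
    shared {t = t} share (Gtw , w∈C , w≢s) with share _ Gtw w∈C w≢s
    ... | inj₁ Gsw = Gsw , w∈C , λ { refl → loops t Gtw }
    ... | inj₂ p   = ⊥-elim (¬p p)

ftd⇒fd : ∀ {n} {G : Graph n} {C} → FTDCode G C → FDCode G C
ftd⇒fd (sep , total) = sep , map₂ (map₁ inj₂) ∘ total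

FTDCodeOfSize : ∀ {n} → Graph n → ℕ → Set
FTDCodeOfSize G k = ∃ λ C → FTDCode G C × ∣ C ∣ ≡ k

minima-from-bounds : ∀ {n} (G : Graph n) k → FTDCodeOfSize G k →
                     (∀ C → FDCode G C → k ≤ ∣ C ∣) → γFD G k × γFTD G k
minima-from-bounds G k (C , code , size) lower =
  ((C , ftd⇒fd code , size) , lower) , ((C , code , size) , λ D → lower D ∘ ftd⇒fd)

-- Paths

module _ {n : ℕ} where

  path-sym : ∀ {u w} → PathG n u w → PathG n w u
  path-sym = Sum.swap

  path-loopless : ∀ w → ¬ PathG n w w
  path-loopless w (inj₁ e) = 1+n≢n e
  path-loopless w (inj₂ e) = 1+n≢n e

  path-≤ : ∀ {u w} → PathG n u w → toℕ w ≤ suc (toℕ u)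
  path-≤ (inj₁ e) = ≤-reflexive (sym e)
  path-≤ (inj₂ e) = ≤-trans (n≤1+n _) (≤-trans (≤-reflexive e) (n≤1+n _))

  index-≢ : ∀ {u v : Fin n} {i j} → toℕ u ≡ i → toℕ v ≡ j → i ≢ j → u ≢ v
  index-≢ ui vj i≢j refl = i≢j (trans (sym ui) vj)

  far⇒≢ : ∀ {u w : Fin n} → 2 + toℕ u ≤ toℕ w → u ≢ w
  far⇒≢ far refl = 1+n≰n (≤-trans (n≤1+n _) far)

  far⇒¬adjacent : ∀ {u w} → 2 + toℕ u ≤ toℕ w → ¬ PathG n u w
  far⇒¬adjacent far = <⇒≱ far ∘ path-≤

module PathNecessary {n} (C : Subset n) where

  private
    G : Graph n
    G = PathG n
    y : ℕ → Bool
    y = pad (indicator C)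

    left-letter : ∀ {u w : Fin n} {i} → suc (toℕ w) ≡ toℕ u → toℕ u ≡ i → w ∈ C → T (y (3 + i))
    left-letter wu ui w∈C = subst (T ∘ y ∘ (3 +_)) (trans wu ui) (∈⇒indicator w∈C)

    right-letter : ∀ {u w : Fin n} {i} → suc (toℕ u) ≡ toℕ w → toℕ u ≡ i → w ∈ C → T (y (5 + i))
    right-letter uw ui w∈C = subst (T ∘ y ∘ (4 +_)) (trans (sym uw) (cong suc ui)) (∈⇒indicator w∈C)

    same-index : ∀ {w v : Fin n} {i} → toℕ w ≡ i → toℕ v ≡ i → w ≢ v → ∀ {A : Set} → A
    same-index wi vi w≢v = ⊥-elim (w≢v (toℕ-injective (trans wi (sym vi))))

  adjacent-rule : FullSeparating G C → ∀ {i} (u v : Fin n) → toℕ u ≡ i → toℕ v ≡ suc i →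
                  T (y (3 + i)) ⊎ T (y (6 + i))
  adjacent-rule sep {i} u v ui vi = separation-forces G C (T? _ ⊎-dec T? _) path-loopless
      (sep u v (index-≢ ui vi (m≢1+n+m i {0}))) shareᵤ shareᵥ
    where
    shareᵤ : ∀ w → G u w → w ∈ C → w ≢ v → G v w ⊎ T (y (3 + i)) ⊎ T (y (6 + i))
    shareᵤ w (inj₁ uw) w∈C w≢v = same-index (trans (sym uw) (cong suc ui)) vi w≢v
    shareᵤ w (inj₂ wu) w∈C w≢v = inj₂ (inj₁ (left-letter wu ui w∈C))
    shareᵥ : ∀ w → G v w → w ∈ C → w ≢ u → G u w ⊎ T (y (3 + i)) ⊎ T (y (6 + i))
    shareᵥ w (inj₁ vw) w∈C w≢u = inj₂ (inj₂ (right-letter vw vi w∈C))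
    shareᵥ w (inj₂ wv) w∈C w≢u = same-index (suc-injective (trans wv vi)) ui w≢u

  distance-two-rule : FullSeparating G C → ∀ {i} (u v : Fin n) → toℕ u ≡ i → toℕ v ≡ 2 + i →
                      T (y (3 + i)) ⊎ T (y (7 + i))
  distance-two-rule sep {i} u v ui vi = separation-forces G C (T? _ ⊎-dec T? _) path-loopless
      (sep u v (index-≢ ui vi (m≢1+n+m i {1}))) shareᵤ shareᵥ
    where
    shareᵤ : ∀ w → G u w → w ∈ C → w ≢ v → G v w ⊎ T (y (3 + i)) ⊎ T (y (7 + i))
    shareᵤ w (inj₁ uw) w∈C w≢v = inj₁ (inj₂ (trans (cong suc (trans (sym uw) (cong suc ui))) (sym vi)))
    shareᵤ w (inj₂ wu) w∈C w≢v = inj₂ (inj₁ (left-letter wu ui w∈C))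
    shareᵥ : ∀ w → G v w → w ∈ C → w ≢ u → G u w ⊎ T (y (3 + i)) ⊎ T (y (7 + i))
    shareᵥ w (inj₁ vw) w∈C w≢u = inj₂ (inj₂ (right-letter vw vi w∈C))
    shareᵥ w (inj₂ wv) w∈C w≢u = inj₁ (inj₁ (trans (cong suc ui) (sym (suc-injective (trans wv vi)))))

  domination-rule : Dominating G C → ∀ {i} (v : Fin n) → toℕ v ≡ i →
                    T (y (3 + i)) ⊎ T (y (4 + i)) ⊎ T (y (5 + i))
  domination-rule dom {i} v vi with dom v
  ... | w , inj₁ refl       , w∈C = inj₂ (inj₁ (subst (T ∘ y ∘ (4 +_)) vi (∈⇒indicator w∈C)))
  ... | w , inj₂ (inj₁ vw) , w∈C = inj₂ (inj₂ (right-letter vw vi w∈C))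
  ... | w , inj₂ (inj₂ wv) , w∈C = inj₁ (left-letter wv vi w∈C)

  path-fdWindows : FDCode G C → Windows fdWindow y (suc n)
  path-fdWindows (sep , dom) {k} (s≤s k≤n) =
    fdWindow-intro (adjacent-letters k k≤n) (distance-two-letters k k≤n) (dominated-letters k k≤n)
    where
    adjacent-letters : ∀ k → k ≤ n → T (y (1 + k)) ⊎ T (y (4 + k))
    adjacent-letters 0 _ = inj₁ _
    adjacent-letters 1 _ = inj₁ _
    adjacent-letters (suc (suc i)) 2+i≤n =
      adjacent-rule sep (fromℕ< (<-trans (n<1+n i) 2+i≤n)) (fromℕ< 2+i≤n) (toℕ-fromℕ< _) (toℕ-fromℕ< _)
    distance-two-letters : ∀ k → k ≤ n → T (y k) ⊎ T (y (4 + k))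
    distance-two-letters 0 _ = inj₁ _
    distance-two-letters 1 _ = inj₁ _
    distance-two-letters 2 _ = inj₁ _
    distance-two-letters (suc (suc (suc i))) 3+i≤n =
      distance-two-rule sep (fromℕ< (<-trans (n<1+n i) (<-trans (n<1+n (suc i)) 3+i≤n))) (fromℕ< 3+i≤n)
                        (toℕ-fromℕ< _) (toℕ-fromℕ< _)
    dominated-letters : ∀ k → k ≤ n → T (y (2 + k)) ⊎ T (y (3 + k)) ⊎ T (y (4 + k))
    dominated-letters 0 _ = inj₁ _
    dominated-letters (suc i) 1+i≤n = domination-rule dom (fromℕ< 1+i≤n) (toℕ-fromℕ< _)

  path-lower-bound : FDCode G C → pathBound n ≤ ∣ C ∣
  path-lower-bound code = begin
    pathBound n                     ≤⟨ minOnes-≤-count pathEnd n y (ws ∘ m≤n⇒m≤1+n) end ⟩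
    count (indicator C) n           ≡⟨ ∣∣≡count C ⟨
    ∣ C ∣                           ∎
    where open ≤-Reasoning
          ws : Windows fdWindow y (suc n)
          ws = path-fdWindows code
          end : T (pathEnd (y n) (y (1 + n)) (y (2 + n)) (y (3 + n)))
          end = subst (T ∘ fdWindow (y n) (y (1 + n)) (y (2 + n)) (y (3 + n))) (indicator-≥ C n ≤-refl)
                      (holds (ws (n<1+n n)))

data Gap (a : ℕ) : ℕ → Set where
  one    : Gap a (1 + a)
  two    : Gap a (2 + a)
  three+ : ∀ o → Gap a (3 + a + o)

gap : ∀ {a b} → a < b → Gap a b
gap {zero}  {1}                   _ = one
gap {zero}  {2}                   _ = two
gap {zero}  {suc (suc (suc o))}   _ = three+ o
gap {suc a} {suc b} (s≤s a<b) with gap a<b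
... | one      = one
... | two      = two
... | three+ o = three+ o

module PathSufficient {n} (C : Subset n) (ws : Windows ftdWindow (pad (indicator C)) (suc n)) where

  private
    G : Graph n
    G = PathG n
    x y : ℕ → Bool
    x = indicator C
    y = pad x

    apart : ∀ {u w : Fin n} {i j} → toℕ u ≡ i → toℕ w ≡ j → 2 + i ≤ j → u ≢ w × ¬ G u w × ¬ G w u
    apart refl refl far = far⇒≢ far , far⇒¬adjacent far , far⇒¬adjacent far ∘ path-sym

    left-neighbour : ∀ i → T (y (3 + i)) → ∃ λ j → suc j ≡ i × T (x j)
    left-neighbour (suc j) h = j , refl , h

    window-at : ∀ {k} (v : Fin n) → toℕ v ≡ k → WindowAt ftdWindow y (suc k)
    window-at v refl = ws (s≤s (toℕ<n v))

    left-private : ∀ {a b} (u v : Fin n) → toℕ u ≡ a → toℕ v ≡ b → a < b → T (y (3 + a)) →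
                   Separates G C u v
    left-private {a} {b} u v ua vb a<b l with left-neighbour a l
    ... | j , ja , xj with letter⇒vertex xj
    ... | w , wj , w∈C with apart wj vb (subst (λ i → suc i ≤ b) (sym ja) a<b)
    ... | w≢v , _ , ¬Gvw = separatesˡ G C (inj₂ (trans (cong suc wj) (trans ja (sym ua)))) w∈C w≢v ¬Gvw

  -- A left neighbour of u in C is private to u; otherwise the window chosen by the gap b - a puts
  -- in C a right neighbour of exactly one of u and v.
  separates-< : ∀ {a b} (u v : Fin n) → toℕ u ≡ a → toℕ v ≡ b → a < b → Separates G C u v
  separates-< {a} {b} u v ua vb a<b with gap a<b
  ... | one with ftdWindow-adjacent (window-at v vb)
  ...   | inj₁ l = left-private u v ua vb a<b l
  ...   | inj₂ r with letter⇒vertex r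
  ...     | w , wj , w∈C with apart ua wj ≤-refl
  ...       | u≢w , ¬Guw , _ = separatesʳ G C (inj₁ (trans (cong suc vb) (sym wj))) w∈C (u≢w ∘ sym) ¬Guw
  separates-< {a} {b} u v ua vb a<b | two with ftdWindow-distance-two (window-at v vb)
  ...   | inj₁ l = left-private u v ua vb a<b l
  ...   | inj₂ r with letter⇒vertex r
  ...     | w , wj , w∈C with apart ua wj (n≤1+n _)
  ...       | u≢w , ¬Guw , _ = separatesʳ G C (inj₁ (trans (cong suc vb) (sym wj))) w∈C (u≢w ∘ sym) ¬Guw
  separates-< {a} {b} u v ua vb a<b | three+ o with ftdWindow-total (window-at u ua)
  ...   | inj₁ l = left-private u v ua vb a<b l
  ...   | inj₂ r with letter⇒vertex r
  ...     | w , wj , w∈C with apart wj vb (m≤m+n _ o)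
  ...       | w≢v , _ , ¬Gvw = separatesˡ G C (inj₁ (trans (cong suc ua) (sym wj))) w∈C w≢v ¬Gvw

  path-ftd : FTDCode G C
  path-ftd = separating , total
    where
    separating : FullSeparating G C
    separating u v u≢v with <-cmp (toℕ u) (toℕ v)
    ... | tri< lt _ _ = separates-< u v refl refl lt
    ... | tri≈ _ eq _ = ⊥-elim (u≢v (toℕ-injective eq))
    ... | tri> _ _ gt = Separates-sym G C (separates-< v u refl refl gt)
    total : TotalDominating G C
    total v with ftdWindow-total (window-at v refl)
    ... | inj₂ r = let w , wj , w∈C = letter⇒vertex r in w , inj₁ (sym wj) , w∈C
    ... | inj₁ l with left-neighbour (toℕ v) l
    ...   | j , jv , xj = let w , wj , w∈C = letter⇒vertex xj in w , inj₂ (trans (cong suc wj) jv) , w∈C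

-- Cycles

module CycleWalk (N : ℕ) .{{_ : NonZero N}} where

  σ : ℕ → Fin N
  σ i = i mod N

  toℕ-σ : ∀ i → toℕ (σ i) ≡ i % N
  toℕ-σ i = toℕ-fromℕ< (m%n<n i N)

  σ-+N : ∀ i → σ (i + N) ≡ σ i
  σ-+N i = toℕ-injective (trans (toℕ-σ (i + N)) (trans ([m+n]%n≡m%n i N) (sym (toℕ-σ i))))

  toℕ-σ-< : ∀ {i} → i < N → toℕ (σ i) ≡ i
  toℕ-σ-< {i} i<N = trans (toℕ-σ i) (m<n⇒m%n≡m i<N)

  σ-toℕ : ∀ u → σ (toℕ u) ≡ u
  σ-toℕ u = toℕ-injective (toℕ-σ-< (toℕ<n u))

  word : Subset N → ℕ → Bool
  word C i = indicator C (toℕ (σ i))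

  _↦_ : ℕ → ℕ → Set
  a ↦ b = suc a ≡ b ⊎ (suc a ≡ N × b ≡ 0)

  cycle⇒↦ : ∀ {u w} → CycleG N u w → toℕ u ↦ toℕ w ⊎ toℕ w ↦ toℕ u
  cycle⇒↦ (inj₁ (inj₁ uw))       = inj₁ (inj₁ uw)
  cycle⇒↦ (inj₁ (inj₂ wu))       = inj₂ (inj₁ wu)
  cycle⇒↦ (inj₂ (inj₁ (u0 , w))) = inj₂ (inj₂ (w , u0))
  cycle⇒↦ (inj₂ (inj₂ (w0 , u))) = inj₁ (inj₂ (u , w0))

  ↦⇒cycle : ∀ {u w} → toℕ u ↦ toℕ w → CycleG N u w
  ↦⇒cycle (inj₁ uw)       = inj₁ (inj₁ uw)
  ↦⇒cycle (inj₂ (u , w0)) = inj₂ (inj₂ (w0 , u))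

  cycle-sym : ∀ {u w} → CycleG N u w → CycleG N w u
  cycle-sym (inj₁ e) = inj₁ (Data.Sum.swap e)
  cycle-sym (inj₂ e) = inj₂ (Data.Sum.swap e)

  ↦-functional : ∀ {a b c} → b < N → c < N → a ↦ b → a ↦ c → b ≡ c
  ↦-functional _   _   (inj₁ ab)       (inj₁ ac)       = trans (sym ab) ac
  ↦-functional b<N _   (inj₁ ab)       (inj₂ (aN , _)) = ⊥-elim (<-irrefl (trans (sym ab) aN) b<N)
  ↦-functional _   c<N (inj₂ (aN , _)) (inj₁ ac)       = ⊥-elim (<-irrefl (trans (sym ac) aN) c<N)
  ↦-functional _   _   (inj₂ (_ , b0)) (inj₂ (_ , c0)) = trans b0 (sym c0)

  ↦-injective : ∀ {a b c} → a ↦ c → b ↦ c → a ≡ b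
  ↦-injective (inj₁ ac)       (inj₁ bc)       = suc-injective (trans ac (sym bc))
  ↦-injective (inj₁ ac)       (inj₂ (_ , c0)) = ⊥-elim (0≢1+n (trans (sym c0) (sym ac)))
  ↦-injective (inj₂ (_ , c0)) (inj₁ bc)       = ⊥-elim (0≢1+n (trans (sym c0) (sym bc)))
  ↦-injective (inj₂ (aN , _)) (inj₂ (bN , _)) = suc-injective (trans aN (sym bN))

  [d+i%N]%N≡[d+i]%N : ∀ d i → (d + i % N) % N ≡ (d + i) % N
  [d+i%N]%N≡[d+i]%N d i = begin
    (d + i % N) % N              ≡⟨ %-distribˡ-+ d (i % N) N ⟩
    (d % N + i % N % N) % N      ≡⟨ cong (λ j → (d % N + j) % N) (m%n%n≡m%n i N) ⟩
    (d % N + i % N) % N          ≡⟨ %-distribˡ-+ d i N ⟨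
    (d + i) % N                  ∎
    where open ≡-Reasoning

  ↦-σ : ∀ i → toℕ (σ i) ↦ toℕ (σ (suc i))
  ↦-σ i rewrite toℕ-σ i | toℕ-σ (suc i) | sym ([d+i%N]%N≡[d+i]%N 1 i) with m≤n⇒m<n∨m≡n (m%n<n i N)
  ... | inj₁ 1+a<N = inj₁ (sym (m<n⇒m%n≡m 1+a<N))
  ... | inj₂ 1+a≡N = inj₂ (1+a≡N , trans (cong (_% N) 1+a≡N) (n%n≡0 N))

  σ-adjacent : ∀ i → CycleG N (σ i) (σ (suc i))
  σ-adjacent i = ↦⇒cycle (↦-σ i)

  cycle-neighbours : ∀ i {w} → CycleG N (σ (suc i)) w → w ≡ σ i ⊎ w ≡ σ (2 + i)
  cycle-neighbours i {w} g with cycle⇒↦ g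
  ... | inj₁ next = inj₂ (toℕ-injective (↦-functional (toℕ<n w) (toℕ<n (σ (2 + i))) next (↦-σ (suc i))))
  ... | inj₂ prev = inj₁ (toℕ-injective (↦-injective prev (↦-σ i)))

  cycle-loopless : 1 < N → ∀ w → ¬ CycleG N w w
  cycle-loopless 1<N w = [ no-loop , no-loop ] ∘ cycle⇒↦
    where no-loop : ¬ (toℕ w ↦ toℕ w)
          no-loop (inj₁ e)        = 1+n≢n e
          no-loop (inj₂ (e , w0)) = <-irrefl (trans (cong suc (sym w0)) e) 1<N

  σ-distinct : ∀ d i → suc d < N → σ (suc d + i) ≢ σ i
  σ-distinct d i d<N eq = apart (trans ([d+i%N]%N≡[d+i]%N (suc d) i)
                                       (trans (sym (toℕ-σ (suc d + i))) (trans (cong toℕ eq) (toℕ-σ i))))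
    where
    a : ℕ
    a = i % N
    apart : (suc d + a) % N ≢ a
    apart eq with suc d + a <? N
    ... | yes lt = m≢1+n+m a (sym (trans (sym (m<n⇒m%n≡m lt)) eq))
    ... | no ≮ = <-irrefl (sym (+-cancelʳ-≡ a N (suc d) N+a≡)) d<N
      where
      N≤ : N ≤ suc d + a
      N≤ = ≮⇒≥ ≮
      a≡ : suc d + a ∸ N ≡ a
      a≡ = begin
        suc d + a ∸ N            ≡⟨ m<n⇒m%n≡m (m<n+o⇒m∸n<o (suc d + a) N (+-mono-< d<N (m%n<n i N))) ⟨
        (suc d + a ∸ N) % N      ≡⟨ m≤n⇒[n∸m]%m≡n%m N≤ ⟩
        (suc d + a) % N          ≡⟨ eq ⟩
        a                        ∎
        where open ≡-Reasoning
      N+a≡ : N + a ≡ suc d + a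
      N+a≡ = trans (+-comm N a) (trans (cong (_+ N) (sym a≡)) (m∸n+n≡m N≤))

module CycleNecessary (L : ℕ) (C : Subset (4 + L)) where

  open CycleWalk (4 + L)

  private
    N : ℕ
    N = 4 + L
    G : Graph N
    G = CycleG N
    x : ℕ → Bool
    x = word C

    member : ∀ j {w} → w ≡ σ j → w ∈ C → T (x j)
    member j refl = ∈⇒indicator

    1<N : 1 < N
    1<N = s<s z<s

    2<N : 2 < N
    2<N = s<s (s<s z<s)

  adjacent-rule : FullSeparating G C → ∀ k → T (x (1 + k)) ⊎ T (x (4 + k))
  adjacent-rule sep k = separation-forces G C (T? _ ⊎-dec T? _) (cycle-loopless 1<N)
      (sep (σ (2 + k)) (σ (3 + k)) (σ-distinct 0 (2 + k) 1<N ∘ sym)) shareᵤ shareᵥ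
    where
    shareᵤ : ∀ w → G (σ (2 + k)) w → w ∈ C → w ≢ σ (3 + k) →
             G (σ (3 + k)) w ⊎ T (x (1 + k)) ⊎ T (x (4 + k))
    shareᵤ w g w∈C w≢v with cycle-neighbours (1 + k) g
    ... | inj₁ p = inj₂ (inj₁ (member (1 + k) p w∈C))
    ... | inj₂ p = ⊥-elim (w≢v p)
    shareᵥ : ∀ w → G (σ (3 + k)) w → w ∈ C → w ≢ σ (2 + k) →
             G (σ (2 + k)) w ⊎ T (x (1 + k)) ⊎ T (x (4 + k))
    shareᵥ w g w∈C w≢u with cycle-neighbours (2 + k) g
    ... | inj₁ p = ⊥-elim (w≢u p)
    ... | inj₂ p = inj₂ (inj₂ (member (4 + k) p w∈C))

  distance-two-rule : FullSeparating G C → ∀ k → T (x k) ⊎ T (x (4 + k))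
  distance-two-rule sep k = separation-forces G C (T? _ ⊎-dec T? _) (cycle-loopless 1<N)
      (sep (σ (1 + k)) (σ (3 + k)) (σ-distinct 1 (1 + k) 2<N ∘ sym)) shareᵤ shareᵥ
    where
    shareᵤ : ∀ w → G (σ (1 + k)) w → w ∈ C → w ≢ σ (3 + k) →
             G (σ (3 + k)) w ⊎ T (x k) ⊎ T (x (4 + k))
    shareᵤ w g w∈C w≢v with cycle-neighbours k g
    ... | inj₁ p = inj₂ (inj₁ (member k p w∈C))
    ... | inj₂ refl = inj₁ (cycle-sym (σ-adjacent (2 + k)))
    shareᵥ : ∀ w → G (σ (3 + k)) w → w ∈ C → w ≢ σ (1 + k) →
             G (σ (1 + k)) w ⊎ T (x k) ⊎ T (x (4 + k))
    shareᵥ w g w∈C w≢u with cycle-neighbours (2 + k) g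
    ... | inj₁ refl = inj₁ (σ-adjacent (1 + k))
    ... | inj₂ p = inj₂ (inj₂ (member (4 + k) p w∈C))

  domination-rule : Dominating G C → ∀ k → T (x (2 + k)) ⊎ T (x (3 + k)) ⊎ T (x (4 + k))
  domination-rule dom k with dom (σ (3 + k))
  ... | w , inj₁ p , w∈C = inj₂ (inj₁ (member (3 + k) p w∈C))
  ... | w , inj₂ g , w∈C with cycle-neighbours (2 + k) g
  ...   | inj₁ p = inj₁ (member (2 + k) p w∈C)
  ...   | inj₂ p = inj₂ (inj₂ (member (4 + k) p w∈C))

  cycle-fdWindow : FDCode G C → ∀ k → WindowAt fdWindow x k
  cycle-fdWindow (sep , dom) k = fdWindow-intro (adjacent-rule sep k) (distance-two-rule sep k) (domination-rule dom k)

  x-periodic : ∀ j → x (j + N) ≡ x j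
  x-periodic j = cong (indicator C ∘ toℕ) (σ-+N j)

  cycle-lower-bound : FDCode G C → cycleBound (x 0) (x 1) (x 2) (x 3) N ≤ ∣ C ∣
  cycle-lower-bound code = begin
    weight (x 0) (x 1) (x 2) (x 3) + minOnes (cycleEnd (x 0) (x 1) (x 2) (x 3)) (x 0) (x 1) (x 2) (x 3) L
      ≤⟨ +-monoʳ-≤ _ (minOnes-≤-count _ L x (λ {k} _ → windows k) end) ⟩
    weight (x 0) (x 1) (x 2) (x 3) + count (x ∘ (4 +_)) L  ≡⟨ count-4+ x L ⟨
    count x N                                              ≡⟨ count-cong N (cong (indicator C) ∘ toℕ-σ-<) ⟩
    count (indicator C) N                                  ≡⟨ ∣∣≡count C ⟨
    ∣ C ∣                                                  ∎
    where
    open ≤-Reasoning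
    windows : ∀ k → WindowAt fdWindow x k
    windows = cycle-fdWindow code
    end : T (cycleEnd (x 0) (x 1) (x 2) (x 3) (x L) (x (1 + L)) (x (2 + L)) (x (3 + L)))
    end rewrite sym (x-periodic 0) | sym (x-periodic 1) | sym (x-periodic 2) | sym (x-periodic 3) =
      cycleEnd-intro (windows L) (windows (1 + L)) (windows (2 + L)) (windows (3 + L))

module CycleSufficient (L : ℕ) (C : Subset (5 + L)) where

  open CycleWalk (5 + L)

  private
    N : ℕ
    N = 5 + L
    G : Graph N
    G = CycleG N
    x : ℕ → Bool
    x = word C

    apart : ∀ d i → d ≤ 3 → σ (suc d + i) ≢ σ i
    apart d i d≤3 = σ-distinct d i (≤-trans (s≤s (s≤s d≤3)) (m≤m+n 5 L))

    apart₁ : ∀ i → σ (1 + i) ≢ σ i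
    apart₁ i = apart 0 i z≤n
    apart₂ : ∀ i → σ (2 + i) ≢ σ i
    apart₂ i = apart 1 i (s≤s z≤n)
    apart₃ : ∀ i → σ (3 + i) ≢ σ i
    apart₃ i = apart 2 i (s≤s (s≤s z≤n))
    apart₄ : ∀ i → σ (4 + i) ≢ σ i
    apart₄ i = apart 3 i (s≤s (s≤s (s≤s z≤n)))

    not-adjacent : ∀ i {w} → w ≢ σ i → w ≢ σ (2 + i) → ¬ G (σ (suc i)) w
    not-adjacent i w≢ w≢′ = [ w≢ , w≢′ ] ∘ cycle-neighbours i

  σ-cover : ∀ u → ∃ λ k → σ (3 + k) ≡ u
  σ-cover u = toℕ u + (2 + L) , trans (cong σ (shift (toℕ u) L)) (trans (σ-+N (toℕ u)) (σ-toℕ u))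
    where shift : ∀ t L → 3 + (t + (2 + L)) ≡ t + (5 + L)
          shift = solve-∀

  module _ (ws : ∀ k → WindowAt ftdWindow x k) where

    separates-successor : ∀ k → Separates G C (σ (2 + k)) (σ (3 + k))
    separates-successor k with ftdWindow-adjacent (ws k)
    ... | inj₁ l = separatesˡ G C (cycle-sym (σ-adjacent (1 + k))) (indicator⇒∈ l) (≢-sym (apart₂ (1 + k)))
                     (not-adjacent (2 + k) (≢-sym (apart₁ (1 + k))) (≢-sym (apart₃ (1 + k))))
    ... | inj₂ r = separatesʳ G C (σ-adjacent (3 + k)) (indicator⇒∈ r) (apart₂ (2 + k))
                     (not-adjacent (1 + k) (apart₃ (1 + k)) (apart₁ (3 + k)))

    separates-second-successor : ∀ k → Separates G C (σ (1 + k)) (σ (3 + k))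
    separates-second-successor k with ftdWindow-distance-two (ws k)
    ... | inj₁ l = separatesˡ G C (cycle-sym (σ-adjacent k)) (indicator⇒∈ l) (≢-sym (apart₃ k))
                     (not-adjacent (2 + k) (≢-sym (apart₂ k)) (≢-sym (apart₄ k)))
    ... | inj₂ r = separatesʳ G C (σ-adjacent (3 + k)) (indicator⇒∈ r) (apart₃ (1 + k))
                     (not-adjacent k (apart₄ k) (apart₂ (2 + k)))

    separates-distant : ∀ k v → σ (3 + k) ≢ v →
                        v ≢ σ (1 + k) → v ≢ σ (2 + k) → v ≢ σ (4 + k) → v ≢ σ (5 + k) →
                        Separates G C (σ (3 + k)) v
    separates-distant k v u≢v v≢1 v≢2 v≢4 v≢5 with ftdWindow-total (ws k)
    ... | inj₁ l = separatesˡ G C (cycle-sym (σ-adjacent (2 + k))) (indicator⇒∈ l) (≢-sym v≢2)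
                     (not-adjacent (1 + k) v≢1 (≢-sym u≢v) ∘ cycle-sym)
    ... | inj₂ r = separatesˡ G C (σ-adjacent (3 + k)) (indicator⇒∈ r) (≢-sym v≢4)
                     (not-adjacent (3 + k) (≢-sym u≢v) v≢5 ∘ cycle-sym)

    -- Shifting k turns a v at distance one or two from σ (3 + k) into one of the two cases above.
    separates-from : ∀ k v → σ (3 + k) ≢ v → Separates G C (σ (3 + k)) v
    separates-from k v u≢v with v ≟ᶠ σ (2 + k) | v ≟ᶠ σ (4 + k) | v ≟ᶠ σ (1 + k) | v ≟ᶠ σ (5 + k)
    ... | yes refl | _      | _      | _      = Separates-sym G C (separates-successor k)
    ... | no _     | yes refl | _    | _      = separates-successor (1 + k)
    ... | no _     | no _   | yes refl | _    = Separates-sym G C (separates-second-successor k)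
    ... | no _     | no _   | no _   | yes refl = separates-second-successor (2 + k)
    ... | no v≢2   | no v≢4 | no v≢1 | no v≢5 = separates-distant k v u≢v v≢1 v≢2 v≢4 v≢5

    cycle-ftd : FTDCode G C
    cycle-ftd = separating , total
      where
      separating : FullSeparating G C
      separating u v u≢v with σ-cover u
      ... | k , refl = separates-from k v u≢v
      total : TotalDominating G C
      total v with σ-cover v
      ... | k , refl with ftdWindow-total (ws k)
      ...   | inj₁ l = σ (2 + k) , cycle-sym (σ-adjacent (2 + k)) , indicator⇒∈ l
      ...   | inj₂ r = σ (4 + k) , σ-adjacent (3 + k) , indicator⇒∈ r


-- Codes from the block 111100

ones : ℕ → ℕ → Bool
ones k i = i <ᵇ k

ones-≥ : ∀ k {i} → k ≤ i → ones k i ≡ false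
ones-≥ zero    _         = refl
ones-≥ (suc k) (s≤s k≤i) = ones-≥ k k≤i

count-ones : ∀ k m → count (ones k) m ≡ k ⊓ m
count-ones k       zero    = sym (⊓-zeroʳ k)
count-ones zero    (suc m) = count-ones zero m
count-ones (suc k) (suc m) = cong suc (count-ones k m)

cons : Bool → (ℕ → Bool) → ℕ → Bool
cons b s zero    = b
cons b s (suc i) = s i

block : (ℕ → Bool) → ℕ → Bool
block s 0 = true
block s 1 = true
block s 2 = true
block s 3 = true
block s 4 = false
block s 5 = false
block s (suc (suc (suc (suc (suc (suc i)))))) = s i

blocks : ℕ → (ℕ → Bool) → ℕ → Bool
blocks zero    s = s
blocks (suc q) s = block (blocks q s)

StartsWith1111 : (ℕ → Bool) → Set
StartsWith1111 s = ∀ {i} → i < 4 → T (s i)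

block-starts : ∀ s → StartsWith1111 (block s)
block-starts s {0} _ = _
block-starts s {1} _ = _
block-starts s {2} _ = _
block-starts s {3} _ = _
block-starts s {suc (suc (suc (suc _)))} (s≤s (s≤s (s≤s (s≤s ()))))

blocks-starts : ∀ {s} → StartsWith1111 s → ∀ q → StartsWith1111 (blocks q s)
blocks-starts h zero    = h
blocks-starts h (suc q) = block-starts _

blocks-+ : ∀ s q i → blocks q s (6 * q + i) ≡ s i
blocks-+ s zero    i = refl
blocks-+ s (suc q) i = trans (cong (blocks (suc q) s) (*-suc-+ 6 q i)) (blocks-+ s q i)

blocks-≥ : ∀ {s c} → (∀ {i} → c ≤ i → s i ≡ false) →
           ∀ q {i} → 6 * q + c ≤ i → blocks q s i ≡ false
blocks-≥ {s} {c} beyond q le with m≤n⇒∃[o]m+o≡n le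
... | o , refl = trans (cong (blocks q s) (+-assoc (6 * q) c o)) (trans (blocks-+ s q (c + o)) (beyond (m≤m+n c o)))

count-blocks : ∀ s q m → count (blocks q s) (6 * q + m) ≡ 4 * q + count s m
count-blocks s zero    m = refl
count-blocks s (suc q) m = begin
  count (blocks (suc q) s) (6 * suc q + m)  ≡⟨ cong (count (blocks (suc q) s)) (*-suc-+ 6 q m) ⟩
  4 + count (blocks q s) (6 * q + m)        ≡⟨ cong (4 +_) (count-blocks s q m) ⟩
  4 + (4 * q + count s m)                   ≡⟨ *-suc-+ 4 q _ ⟨
  4 * suc q + count s m                     ∎
  where open ≡-Reasoning

block-windows : ∀ {s B} → StartsWith1111 s → Windows ftdWindow s B → Windows ftdWindow (block s) (6 + B)
block-windows _ _ {0} _ = window _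
block-windows _ _ {1} _ = window _
block-windows h _ {2} _ = ftdWindow-last (h z<s)
block-windows h _ {3} _ = ftdWindow-last (h (s<s z<s))
block-windows h _ {4} _ = ftdWindow-last (h (s<s (s<s z<s)))
block-windows h _ {5} _ = ftdWindow-last (h (s<s (s<s (s<s z<s))))
block-windows _ ws {suc (suc (suc (suc (suc (suc k)))))} (s≤s (s≤s (s≤s (s≤s (s≤s (s≤s k<B)))))) =
  window (holds (ws k<B))

blocks-windows : ∀ {s B} → StartsWith1111 s → Windows ftdWindow s B →
                 ∀ q → Windows ftdWindow (blocks q s) (6 * q + B)
blocks-windows h ws zero    = ws
blocks-windows {B = B} h ws (suc q) = Windows-mono (≤-reflexive (*-suc-+ 6 q B))
  (block-windows (blocks-starts h q) (blocks-windows h ws q))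

cons-windows : ∀ {s B} → T (s 3) → Windows ftdWindow s B → Windows ftdWindow (cons false s) (suc B)
cons-windows s₃ _ {zero} _ = ftdWindow-last s₃
cons-windows _ ws {suc k} (s≤s k<B) = window (holds (ws k<B))

pad-windows : ∀ {s B} → T (s 1) → T (s 2) → T (s 3) → Windows ftdWindow s B →
              Windows ftdWindow (pad s) (4 + B)
pad-windows _ _ _ _ {0} _ = window _
pad-windows s₁ _ _ _ {1} _ = ftdWindow-last s₁
pad-windows _ s₂ _ _ {2} _ = ftdWindow-last s₂
pad-windows _ _ s₃ _ {3} _ = ftdWindow-last s₃
pad-windows _ _ _ ws {suc (suc (suc (suc k)))} (s≤s (s≤s (s≤s (s≤s k<B)))) = window (holds (ws k<B))

pad-cong : ∀ {x x′} → (∀ i → x i ≡ x′ i) → ∀ i → pad x i ≡ pad x′ i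
pad-cong x≗x′ 0 = refl
pad-cong x≗x′ 1 = refl
pad-cong x≗x′ 2 = refl
pad-cong x≗x′ 3 = refl
pad-cong x≗x′ (suc (suc (suc (suc i)))) = x≗x′ i

path-code : ∀ n (s : ℕ → Bool) → (∀ {i} → n ≤ i → s i ≡ false) → Windows ftdWindow (pad s) (suc n) →
            FTDCodeOfSize (PathG n) (count s n)
path-code n s beyond ws =
  C , PathSufficient.path-ftd C windows , trans (∣∣≡count C) (count-cong n λ {i} _ → agree i)
  where
  C : Subset n
  C = tabulate (s ∘ toℕ)
  agree : ∀ i → indicator C i ≡ s i
  agree i with i <? n
  ... | yes i<n = indicator-tabulate n s i<n
  ... | no  i≮n = trans (indicator-≥ C i (≮⇒≥ i≮n)) (sym (beyond (≮⇒≥ i≮n)))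
  windows : Windows ftdWindow (pad (indicator C)) (suc n)
  windows {k} = WindowAt-transport (λ {j} _ → pad-cong (sym ∘ agree) (j + k)) ∘ ws

ones-windows : ∀ {r} → r < 5 → Windows ftdWindow (ones (4 + r)) (2 + r)
ones-windows = from-yes (allUpTo? (λ r → allUpTo? (window? ftdWindow (ones (4 + r))) (2 + r)) 5)

ones-< : ∀ {k i} → i < k → T (ones k i)
ones-< {suc k} {zero}  _         = _
ones-< {suc k} {suc i} (s≤s i<k) = ones-< i<k

ones-starts : ∀ r → StartsWith1111 (ones (4 + r))
ones-starts r i<4 = ones-< (≤-trans i<4 (m≤m+n 4 r))

-- 0 (111100)^q 1^(4+r)
path-code-short-tail : ∀ q r → r < 4 → FTDCodeOfSize (PathG (6 * suc q + r)) (4 * suc q + r)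
path-code-short-tail q r r<4 = subst₂ (λ n k → FTDCodeOfSize (PathG n) k) (sym (n≡ q r)) size≡
  (path-code _ s beyond (Windows-mono (≤-reflexive (n≡′ (6 * q) r)) windows))
  where
  t s : ℕ → Bool
  t = ones (4 + r)
  s = cons false (blocks q t)
  n≡ : ∀ q r → 6 * suc q + r ≡ suc (6 * q + (5 + r))
  n≡ = solve-∀
  size≡ : count s (suc (6 * q + (5 + r))) ≡ 4 * suc q + r
  size≡ = begin
    count (blocks q t) (6 * q + (5 + r))  ≡⟨ count-blocks t q (5 + r) ⟩
    4 * q + count t (5 + r)              ≡⟨ cong (4 * q +_) (count-ones (4 + r) (5 + r)) ⟩
    4 * q + (4 + r) ⊓ (5 + r)            ≡⟨ cong (4 * q +_) (m≤n⇒m⊓n≡m (n≤1+n (4 + r))) ⟩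
    4 * q + (4 + r)                      ≡⟨ regroup q r ⟩
    4 * suc q + r                        ∎
    where open ≡-Reasoning
          regroup : ∀ q r → 4 * q + (4 + r) ≡ 4 * suc q + r
          regroup = solve-∀
  beyond : ∀ {i} → suc (6 * q + (5 + r)) ≤ i → s i ≡ false
  beyond {suc i} (s≤s le) = blocks-≥ (ones-≥ (4 + r)) q (≤-trans (+-monoʳ-≤ (6 * q) (n≤1+n (4 + r))) le)
  windows : Windows ftdWindow (pad s) (4 + suc (6 * q + (2 + r)))
  windows = let h = blocks-starts (ones-starts r) q
            in pad-windows (h z<s) (h (s<s z<s)) (h (s<s (s<s z<s)))
                 (cons-windows (h (s<s (s<s (s<s z<s))))
                   (blocks-windows (ones-starts r) (ones-windows (m<n⇒m<1+n r<4)) q))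
  n≡′ : ∀ m r → suc (suc (m + (5 + r))) ≡ 4 + suc (m + (2 + r))
  n≡′ = solve-∀

-- (111100)^q 1111 0^(r-4)
path-code-long-tail : ∀ q r → 4 ≤ r → r ≤ 5 → FTDCodeOfSize (PathG (6 * q + r)) (4 * q + 4)
path-code-long-tail q r 4≤r r≤5 = subst (FTDCodeOfSize (PathG _)) size≡
  (path-code _ s beyond
    (Windows-mono (≤-trans (s≤s (+-monoʳ-≤ (6 * q) r≤5)) (≤-reflexive (n≡ (6 * q)))) windows))
  where
  s : ℕ → Bool
  s = blocks q (ones 4)
  beyond : ∀ {i} → 6 * q + r ≤ i → s i ≡ false
  beyond le = blocks-≥ (ones-≥ 4) q (≤-trans (+-monoʳ-≤ (6 * q) 4≤r) le)
  windows : Windows ftdWindow (pad s) (4 + (6 * q + 2))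
  windows = let h = blocks-starts (ones-starts 0) q
            in pad-windows (h (s<s z<s)) (h (s<s (s<s z<s))) (h (s<s (s<s (s<s z<s))))
                 (blocks-windows (ones-starts 0) (ones-windows {0} z<s) q)
  n≡ : ∀ m → suc (m + 5) ≡ 4 + (m + 2)
  n≡ = solve-∀
  size≡ : count s (6 * q + r) ≡ 4 * q + 4
  size≡ = trans (count-blocks (ones 4) q r) (cong (4 * q +_) (trans (count-ones 4 r) (m≤n⇒m⊓n≡m 4≤r)))

path-codes : ∀ q r → r < 6 → 4 ≤ 6 * q + r → FTDCodeOfSize (PathG (6 * q + r)) (target q r)
path-codes q       4 _ _ = path-code-long-tail q 4 ≤-refl (n≤1+n 4)
path-codes q       5 _ _ = path-code-long-tail q 5 (n≤1+n 4) ≤-refl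
path-codes (suc q) 0 _ _ = path-code-short-tail q 0 (s≤s z≤n)
path-codes (suc q) 1 _ _ = path-code-short-tail q 1 (s≤s (s≤s z≤n))
path-codes (suc q) 2 _ _ = path-code-short-tail q 2 (s≤s (s≤s (s≤s z≤n)))
path-codes (suc q) 3 _ _ = path-code-short-tail q 3 (s≤s (s≤s (s≤s (s≤s z≤n))))
path-codes zero    0 _ ()
path-codes zero    1 _ (s≤s ())
path-codes zero    2 _ (s≤s (s≤s ()))
path-codes zero    3 _ (s≤s (s≤s (s≤s ())))
path-codes q (suc (suc (suc (suc (suc (suc r)))))) (s≤s (s≤s (s≤s (s≤s (s≤s (s≤s ())))))) _

module _ (L : ℕ) where

  open CycleWalk (5 + L)

  private
    N : ℕ
    N = 5 + L

  cycle-code : (s : ℕ → Bool) → (∀ {i} → i < 4 → s (N + i) ≡ s i) → Windows ftdWindow s N →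
               FTDCodeOfSize (CycleG N) (count s N)
  cycle-code s wrap ws = C , CycleSufficient.cycle-ftd L C cyclic-windows ,
                         trans (∣∣≡count C) (count-cong N (indicator-tabulate N s))
    where
    C : Subset N
    C = tabulate (s ∘ toℕ)
    mod-wrap : ∀ {m j} → m < N → j ≤ 4 → s ((j + m) % N) ≡ s (j + m)
    mod-wrap {m} {j} m<N j≤4 with j + m <? N
    ... | yes j+m<N = cong s (m<n⇒m%n≡m j+m<N)
    ... | no j+m≮N with m≤n⇒∃[o]m+o≡n (≮⇒≥ j+m≮N)
    ...   | o , N+o≡ = begin
      s ((j + m) % N)     ≡⟨ cong (λ i → s (i % N)) (trans (sym N+o≡) (+-comm N o)) ⟩
      s ((o + N) % N)     ≡⟨ cong s (trans ([m+n]%n≡m%n o N) (m<n⇒m%n≡m (<-trans o<4 (m≤m+n 5 L)))) ⟩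
      s o                 ≡⟨ wrap o<4 ⟨
      s (N + o)           ≡⟨ cong s N+o≡ ⟩
      s (j + m)           ∎
      where
      open ≡-Reasoning
      o<4 : o < 4
      o<4 = +-cancelˡ-< N o 4 (subst (_< N + 4) (sym N+o≡) (subst (j + m <_) (+-comm 4 N) (+-mono-≤-< j≤4 m<N)))
    cyclic-windows : ∀ k → WindowAt ftdWindow (word C) k
    cyclic-windows k = WindowAt-transport letter (ws (m%n<n k N))
      where
      letter : ∀ {j} → j ≤ 4 → s (j + k % N) ≡ word C (j + k)
      letter {j} j≤4 = begin
        s (j + k % N)                       ≡⟨ mod-wrap (m%n<n k N) j≤4 ⟨
        s ((j + k % N) % N)                 ≡⟨ cong s ([d+i%N]%N≡[d+i]%N j k) ⟩
        s ((j + k) % N)                     ≡⟨ cong s (toℕ-σ (j + k)) ⟨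
        s (toℕ (σ (j + k)))                 ≡⟨ indicator-tabulate N s (toℕ<n (σ (j + k))) ⟨
        word C (j + k)                      ∎
        where open ≡-Reasoning

-- 1^r for r ≤ 4 and 11110 for r = 5, followed by the letters that close the cycle
cycleTail : ℕ → ℕ → Bool
cycleTail 5 i = not (i ≡ᵇ 4) ∧ ones 9 i
cycleTail r i = ones (4 + r) i

cycleTail-facts : ∀ {r} → r < 6 →
  StartsWith1111 (cycleTail r) × Windows ftdWindow (cycleTail r) r ×
  (∀ {i} → i < 4 → T (cycleTail r (r + i))) × count (cycleTail r) r ≡ target 0 r
cycleTail-facts = from-yes (allUpTo? (λ r →
  allUpTo? (λ i → T? (cycleTail r i)) 4 ×-dec allUpTo? (window? ftdWindow (cycleTail r)) r ×-dec
  allUpTo? (λ i → T? (cycleTail r (r + i))) 4 ×-dec count (cycleTail r) r ≟ target 0 r) 6)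

cycle-codes : ∀ L q r → r < 6 → 5 + L ≡ 6 * q + r → FTDCodeOfSize (CycleG (5 + L)) (target q r)
cycle-codes L q r r<6 eq with cycleTail-facts r<6
... | starts , windows , restarts , size =
  subst (FTDCodeOfSize _) size≡
    (cycle-code L s wrap (Windows-mono (≤-reflexive eq) (blocks-windows starts windows q)))
  where
  s : ℕ → Bool
  s = blocks q (cycleTail r)
  wrap : ∀ {i} → i < 4 → s (5 + L + i) ≡ s i
  wrap {i} i<4 = trans (to (T-≡ {s (5 + L + i)}) (subst T (sym after) (restarts i<4)))
                       (sym (to (T-≡ {s i}) (blocks-starts starts q i<4)))
    where after : s (5 + L + i) ≡ cycleTail r (r + i)
          after = trans (cong (λ n → s (n + i)) eq) (trans (cong s (+-assoc (6 * q) r i)) (blocks-+ _ q (r + i)))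
  size≡ : count s (5 + L) ≡ target q r
  size≡ = begin
    count s (5 + L)                 ≡⟨ cong (count s) eq ⟩
    count s (6 * q + r)             ≡⟨ count-blocks (cycleTail r) q r ⟩
    4 * q + count (cycleTail r) r   ≡⟨ cong (4 * q +_) size ⟩
    4 * q + target 0 r              ≡⟨ target-blocks q r ⟨
    target q r                      ∎
    where open ≡-Reasoning

target-≤-path-code : ∀ q r → r < 6 → 4 ≤ 6 * q + r →
                     ∀ C → FDCode (PathG (6 * q + r)) C → target q r ≤ ∣ C ∣
target-≤-path-code q r r<6 4≤n C code =
  ≤-trans (pathBound-target q r r<6 4≤n) (PathNecessary.path-lower-bound C code)

target-≤-cycle-code : ∀ L q r → r < 6 → 5 + L ≡ 6 * q + r →
                      ∀ C → FDCode (CycleG (5 + L)) C → target q r ≤ ∣ C ∣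
target-≤-cycle-code L q r r<6 eq C code = ≤-trans
  (subst (λ n → target q r ≤ cycleBound (x 0) (x 1) (x 2) (x 3) n) (sym eq)
         (cycleBound-target (x 0) (x 1) (x 2) (x 3) q r r<6 (subst (5 ≤_) eq (m≤m+n 5 L))))
  (CycleNecessary.cycle-lower-bound (1 + L) C code)
  where x : ℕ → Bool
        x = CycleWalk.word (5 + L) C

theorem6 : (n q r : ℕ) → r < 6 → n ≡ 6 * q + r → (G : Graph n) →
    (G ≡ PathG n × 4 ≤ n) ⊎ (G ≡ CycleG n × 5 ≤ n) →
    γFD G (target q r) × γFTD G (target q r)
theorem6 .(6 * q + r) q r r<6 refl .(PathG (6 * q + r)) (inj₁ (refl , 4≤n)) =
  minima-from-bounds (PathG (6 * q + r)) (target q r) (path-codes q r r<6 4≤n) (target-≤-path-code q r r<6 4≤n)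
theorem6 n q r r<6 n≡ .(CycleG n) (inj₂ (refl , 5≤n)) with m≤n⇒∃[o]m+o≡n 5≤n
... | L , refl = minima-from-bounds (CycleG (5 + L)) (target q r)
                   (cycle-codes L q r r<6 n≡) (target-≤-cycle-code L q r r<6 n≡)
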